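{- Let $G$ be a perfectly orientable plabic graph with boundary vertices $b_1,\dots,b_n$, let $M=M_G$ be its positroid, let $\mathcal{O}$ be a perfect orientation of $G$, and let $I=I_{\mathcal{O}}$. Then for $i\in I$ and $j\in[n]-I$, the set $J=I-\{i\}\cup\{j\}$ is a basis of $M$ (i.e., there is a basis exchange between $I$ and $J$) if and only if there is a directed path in $\mathcal{O}$ from the boundary vertex $b_i$ to the boundary vertex $b_j$.
   Context: A plabic graph is an undirected graph $G$ drawn in a disk (up to homotopy) with $n$ boundary vertices $b_1,\dots,b_n$ on the boundary circle in clockwise order and internal vertices strictly inside the disk, each internal vertex colored black or white, such that each boundary vertex is incident to exactly one edge. A perfect orientation $\mathcal{O}$ of $G$ is an orientation of its edges such that each black internal vertex has exactly one outgoing edge and each white internal vertex has exactly one incoming edge; $G$ is perfectly orientable if it has one. The source set $I_{\mathcal{O}}$ is the set of $i\in[n]$ such that $b_i$ is a source of the oriented graph. For a perfectly orientable plabic graph $G$, the collection $\{I_{\mathcal{O}} : \mathcal{O} \text{ a perfect orientation of } G\}$ is the set of bases of a matroid (in fact a positroid) $M_G$ on $[n]$. -}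

module Defs where

open import Data.Nat using (ℕ)
open import Data.Fin using (Fin)
open import Data.Bool using (Bool; true; false)
open import Data.Sum using (_⊎_; inj₁; inj₂)
open import Data.Product using (Σ; _×_; ∃; _,_)
open import Data.List using (List; []; _∷_)
open import Data.List.Relation.Unary.Unique.Propositional using (Unique)
open import Relation.Binary.PropositionalEquality using (_≡_; _≢_)
open import Relation.Nullary using (¬_)

data Colour : Set where
  black white : Colour

-- Vertices of a graph with n boundary and m internal vertices:
-- inj₁ i is the boundary vertex b_(i+1) (boundary vertices are indexed by
-- Fin n in clockwise order), inj₂ v is an internal vertex.
Vertex : ℕ → ℕ → Set
Vertex n m = Fin n ⊎ Fin m

halfEnd : {V : Set} {k : ℕ} → (Fin k → V) → (Fin k → V) → Fin k × Bool → V
halfEnd f g (e , true)  = f e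
halfEnd f g (e , false) = g e

-- Each boundary vertex is incident to exactly one
-- edge (ends counted with multiplicity, so a loop counts twice).
-- The embedding in the disk is not recorded.
record PlabicGraph (n : ℕ) : Set where
  field
    nInt   : ℕ
    colour : Fin nInt → Colour
    nEdge  : ℕ
    end₁   : Fin nEdge → Vertex n nInt
    end₂   : Fin nEdge → Vertex n nInt
    boundaryDeg1 : (i : Fin n) →
      Σ (Fin nEdge × Bool) λ h → halfEnd end₁ end₂ h ≡ inj₁ i ×
        ((h' : Fin nEdge × Bool) → halfEnd end₁ end₂ h' ≡ inj₁ i → h' ≡ h)

-- An orientation: true means the edge is directed end₁ → end₂,
-- false means end₂ → end₁.
module _ {n : ℕ} (G : PlabicGraph n) where
  open PlabicGraph G

  Orientation : Set
  Orientation = Fin nEdge → Bool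

  tail : Orientation → Fin nEdge → Vertex n nInt
  tail O e with O e
  ... | true  = end₁ e
  ... | false = end₂ e

  head : Orientation → Fin nEdge → Vertex n nInt
  head O e with O e
  ... | true  = end₂ e
  ... | false = end₁ e

  ExactlyOneEdge : (Fin nEdge → Set) → Set
  ExactlyOneEdge P = Σ (Fin nEdge) λ e → P e × ((e' : Fin nEdge) → P e' → e' ≡ e)

  IsPerfect : Orientation → Set
  IsPerfect O = (v : Fin nInt) →
    (colour v ≡ black → ExactlyOneEdge (λ e → tail O e ≡ inj₂ v)) ×
    (colour v ≡ white → ExactlyOneEdge (λ e → head O e ≡ inj₂ v))

  record PerfectOrientation : Set where
    field
      orient  : Orientation
      perfect : IsPerfect orient

  InSourceSet : Orientation → Fin n → Set
  InSourceSet O i = (e : Fin nEdge) → head O e ≢ inj₁ i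

  -- Bases of the positroid M_G, as subsets of [n] given by predicates:
  -- B is a basis iff B = I_O' for some perfect orientation O'.
  IsBasis : (Fin n → Set) → Set
  IsBasis B = Σ PerfectOrientation λ O' →
    (x : Fin n) → (InSourceSet (PerfectOrientation.orient O') x → B x) ×
                  (B x → InSourceSet (PerfectOrientation.orient O') x)

  data Walk (O : Orientation) : Vertex n nInt → Vertex n nInt → Set where
    [] : ∀ {u} → Walk O u u
    step : ∀ {u v} (e : Fin nEdge) → tail O e ≡ u → Walk O (head O e) v → Walk O u v

  walkVertices : ∀ {O u v} → Walk O u v → List (Vertex n nInt)
  walkVertices {u = u} [] = u ∷ []
  walkVertices {u = u} (step e _ w) = u ∷ walkVertices w

  DirectedPath : Orientation → Vertex n nInt → Vertex n nInt → Set
  DirectedPath O u v = Σ (Walk O u v) λ w → Unique (walkVertices w)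

-- Both directions compare O with a second perfect
-- orientation O' through the set of edges on which the two differ.
--
--  * Path ⇒ basis: reversing every edge of a directed path from b_i to b_j
--    keeps the orientation perfect, because every internal vertex of the
--    path is entered and left by exactly one path edge; and it turns b_i into
--    a non-source and b_j into a source while leaving every other boundary
--    vertex alone.  So J is the source set of the reversed orientation.
--  * Basis ⇒ path: if O' is perfect with source set J, the edges D reversed
--    by O' leave distinct vertices, and every internal vertex left by a
--    D-edge is also entered by one (perfectness at that vertex in O and O').
--    Following D-edges backwards from b_j therefore traces a directed path of
--    O, which cannot revisit a vertex and so must stop at a boundary vertex;
--    the only boundary vertex left by a D-edge is b_i.

module Submission where

open import Defs
open import Data.Nat using (ℕ; zero; suc; s≤s; _+_; _≤_; _≤?_) renaming (_<_ to _<ℕ_)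
open import Data.Nat.Properties using (≰⇒>; <⇒≱; +-suc; +-identityʳ; n<1+n; m<n⇒m<1+n)
open import Data.Fin using (Fin; zero; suc; join; splitAt) renaming (_<_ to _<ᶠ_)
open import Data.Fin.Properties using (pigeonhole; splitAt-join; ¬∀⟶∃¬) renaming (_≟_ to _≟ᶠ_)
open import Data.Bool using (Bool; true; false; not)
open import Data.Bool.Properties using (not-involutive; not-¬; ¬-not) renaming (_≟_ to _≟ᵇ_)
open import Data.Sum using (_⊎_; inj₁; inj₂)
open import Data.Sum.Properties using (inj₁-injective; ≡-dec)
open import Data.Product using (Σ; Σ-syntax; _×_; _,_; proj₁; proj₂)
open import Data.Product.Properties using (,-injectiveˡ; ,-injectiveʳ)
open import Data.List using (List; []; _∷_; length; lookup)
open import Data.List.Relation.Unary.Any using (here; there)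
import Data.List.Relation.Unary.All as All
open import Data.List.Relation.Unary.All.Properties using (All¬⇒¬Any; ¬Any⇒All¬)
open import Data.List.Relation.Unary.AllPairs using ([]; _∷_)
open import Data.List.Membership.Propositional using (_∈_; _∉_)
open import Data.List.Membership.Propositional.Properties using (∈-lookup)
open import Data.List.Relation.Unary.Unique.Propositional using (Unique)
open import Data.Empty using (⊥; ⊥-elim)
open import Relation.Binary.PropositionalEquality using (_≡_; _≢_; refl; sym; trans; cong; subst)
open import Relation.Nullary using (¬_; Dec; yes; no)
open import Relation.Nullary.Decidable using (decidable-stable; ¬?; _⊎-dec_)
open import Relation.Unary using (Decidable)
open import Function using (_∘_)
open import Function.Definitions using (Injective)
open import Function.Bundles using (_⇔_; mk⇔)

module _ {A : Set} where

  unique-lookup : (xs : List A) → Unique xs → {a b : Fin (length xs)} →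
                  a <ᶠ b → lookup xs a ≢ lookup xs b
  unique-lookup (x ∷ xs) (x∉xs ∷ _)  {zero}  {suc b} _         = All.lookup x∉xs (∈-lookup b)
  unique-lookup (x ∷ xs) (_ ∷ xs-uq) {suc a} {suc b} (s≤s a<b) = unique-lookup xs xs-uq a<b

  unique-length≤ : {m : ℕ} (f : A → Fin m) → Injective _≡_ _≡_ f →
                   (xs : List A) → Unique xs → length xs ≤ m
  unique-length≤ {m} f f-inj xs xs-uq = decidable-stable (length xs ≤? m) λ long →
    let a , b , a<b , same = pigeonhole (≰⇒> long) (f ∘ lookup xs)
    in unique-lookup xs xs-uq a<b (f-inj same)

ExactlyOne : {E : Set} → (E → Set) → Set
ExactlyOne {E} Q = Σ E λ e → Q e × ((e' : E) → Q e' → e' ≡ e)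

exactly-one-unique : {E : Set} {Q : E → Set} → ExactlyOne Q →
                     ∀ {e f} → Q e → Q f → e ≡ f
exactly-one-unique (_ , _ , only) qe qf = trans (only _ qe) (sym (only _ qf))

-- Edges E with endpoint maps a, b into V, and a map a' that agrees with b on
-- a decidable edge set P and with a off P.  (Typically a, b are the tail and
-- head maps of an orientation and a' is the tail map after reversing P.)
-- The lemmas compare the edges with a given end v before and after.
module Rerouting {E V : Set} {P : E → Set} (P? : Decidable P) (a b a' : E → V)
                 (a'-on : ∀ {e} → P e → a' e ≡ b e) (a'-off : ∀ {e} → ¬ P e → a' e ≡ a e)
                 {v : V} where

  a'-cases : ∀ {e} → a' e ≡ v → (P e × b e ≡ v) ⊎ (¬ P e × a e ≡ v)
  a'-cases {e} a'e with P? e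
  ... | yes pe = inj₁ (pe , trans (sym (a'-on pe)) a'e)
  ... | no ¬pe = inj₂ (¬pe , trans (sym (a'-off ¬pe)) a'e)

  none-rerouted : (∀ {e} → P e → b e ≡ v → Σ[ f ∈ E ] P f × a f ≡ v) →
                  (∀ e → a e ≢ v) → ∀ e → a' e ≢ v
  none-rerouted b⇒a no-a e a'e with a'-cases a'e
  ... | inj₁ (pe , be) = let f , _ , af = b⇒a pe be in no-a f af
  ... | inj₂ (_ , ae)  = no-a e ae

  unique-rerouted : (∀ {e f} → P e → P f → b e ≡ v → b f ≡ v → e ≡ f) →
                    (∀ {e} → P e → a e ≡ v → Σ[ f ∈ E ] P f × b f ≡ v) →
                    (∀ {e} → P e → b e ≡ v → Σ[ f ∈ E ] P f × a f ≡ v) →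
                    ExactlyOne (λ e → a e ≡ v) → ExactlyOne (λ e → a' e ≡ v)
  unique-rerouted b-inj a⇒b b⇒a (e₀ , ae₀ , only-e₀) with P? e₀
  ... | no ¬pe₀ = e₀ , trans (a'-off ¬pe₀) ae₀ , only-e₀'
    where
    only-e₀' : ∀ e → a' e ≡ v → e ≡ e₀
    only-e₀' e a'e with a'-cases a'e
    ... | inj₁ (pe , be) = let g , pg , ag = b⇒a pe be in ⊥-elim (¬pe₀ (subst P (only-e₀ g ag) pg))
    ... | inj₂ (_ , ae)  = only-e₀ e ae
  ... | yes pe₀ with a⇒b pe₀ ae₀
  ...   | f , pf , bf = f , trans (a'-on pf) bf , only-f
    where
    only-f : ∀ e → a' e ≡ v → e ≡ f
    only-f e a'e with a'-cases a'e
    ... | inj₁ (pe , be)  = b-inj pe pf be bf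
    ... | inj₂ (¬pe , ae) = ⊥-elim (¬pe (subst P (sym (only-e₀ e ae)) pe₀))

  rerouted-in-P : ExactlyOne (λ e → a e ≡ v) → Σ[ e ∈ E ] a' e ≡ v →
                  Σ[ e ∈ E ] P e × a e ≡ v → Σ[ f ∈ E ] P f × b f ≡ v
  rerouted-in-P unique-a (f , a'f) (e , pe , ae) with a'-cases a'f
  ... | inj₁ (pf , bf) = f , pf , bf
  ... | inj₂ (¬pf , af) = ⊥-elim (¬pf (subst P (exactly-one-unique unique-a ae af) pe))

module PlabicFacts {n : ℕ} (G : PlabicGraph n) where
  open PlabicGraph G

  V : Set
  V = Vertex n nInt

  _≟V_ : (x y : V) → Dec (x ≡ y)
  _≟V_ = ≡-dec _≟ᶠ_ _≟ᶠ_

  join-injective : Injective _≡_ _≡_ (join n nInt)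
  join-injective {x} {y} same =
    trans (sym (splitAt-join n nInt x)) (trans (cong (splitAt n) same) (splitAt-join n nInt y))

  Exchange : Orientation G → Fin n → Fin n → Fin n → Set
  Exchange O i j x = (InSourceSet G O x × x ≢ i) ⊎ x ≡ j

  HasSourceSet : Orientation G → (Fin n → Set) → Set
  HasSourceSet O B = (x : Fin n) → (InSourceSet G O x → B x) × (B x → InSourceSet G O x)

  source≢non-source : ∀ O {i j} → InSourceSet G O i → ¬ InSourceSet G O j → i ≢ j
  source≢non-source O src-i nsrc-j i≡j = nsrc-j (subst (InSourceSet G O) i≡j src-i)

  half : Fin nEdge × Bool → V
  half = halfEnd end₁ end₂

  tail-half : ∀ O e → tail G O e ≡ half (e , O e)
  tail-half O e with O e
  ... | true  = refl
  ... | false = refl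

  head-half : ∀ O e → head G O e ≡ half (e , not (O e))
  head-half O e with O e
  ... | true  = refl
  ... | false = refl

  tail-end : ∀ O {e x} → tail G O e ≡ x → half (e , O e) ≡ x
  tail-end O {e} te = trans (sym (tail-half O e)) te

  head-end : ∀ O {e x} → head G O e ≡ x → half (e , not (O e)) ≡ x
  head-end O {e} he = trans (sym (head-half O e)) he

  boundary-half-unique : ∀ {x} h h' → half h ≡ inj₁ x → half h' ≡ inj₁ x → h ≡ h'
  boundary-half-unique {x} _ _ = exactly-one-unique (boundaryDeg1 x)

  boundary-tails-unique : ∀ O {e f x} → tail G O e ≡ inj₁ x → tail G O f ≡ inj₁ x → e ≡ f
  boundary-tails-unique O {e} {f} te tf =
    ,-injectiveˡ (boundary-half-unique (e , O e) (f , O f) (tail-end O te) (tail-end O tf))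

  boundary-heads-unique : ∀ O {e f x} → head G O e ≡ inj₁ x → head G O f ≡ inj₁ x → e ≡ f
  boundary-heads-unique O {e} {f} he hf =
    ,-injectiveˡ (boundary-half-unique (e , not (O e)) (f , not (O f)) (head-end O he) (head-end O hf))

  boundary-tail-not-head : ∀ O {e f x} → tail G O e ≡ inj₁ x → head G O f ≢ inj₁ x
  boundary-tail-not-head O {e} {f} te hf =
    not-¬ refl (subst (λ g → O g ≡ not (O f)) (,-injectiveˡ same) (,-injectiveʳ same))
    where
    same : (e , O e) ≡ (f , not (O f))
    same = boundary-half-unique (e , O e) (f , not (O f)) (tail-end O te) (head-end O hf)

  reverseOn : {P : Fin nEdge → Set} → Decidable P → Orientation G → Orientation G
  reverseOn P? O e with P? e
  ... | yes _ = not (O e)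
  ... | no _  = O e

  reverseOn-on : ∀ {P} (P? : Decidable P) O {e} → P e → reverseOn P? O e ≡ not (O e)
  reverseOn-on P? O {e} pe with P? e
  ... | yes _  = refl
  ... | no ¬pe = ⊥-elim (¬pe pe)

  reverseOn-off : ∀ {P} (P? : Decidable P) O {e} → ¬ P e → reverseOn P? O e ≡ O e
  reverseOn-off P? O {e} ¬pe with P? e
  ... | yes pe = ⊥-elim (¬pe pe)
  ... | no _   = refl

  module Compare (O O' : Orientation G) where

    Reverses : Fin nEdge → Set
    Reverses e = O' e ≡ not (O e)

    reverses? : Decidable Reverses
    reverses? e = O' e ≟ᵇ not (O e)

    agrees : ∀ {e} → ¬ Reverses e → O' e ≡ O e
    agrees ¬r = trans (¬-not ¬r) (not-involutive _)

    reversed-tail : ∀ {e} → Reverses e → tail G O' e ≡ head G O e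
    reversed-tail {e} r =
      trans (tail-half O' e) (trans (cong (λ s → half (e , s)) r) (sym (head-half O e)))

    reversed-head : ∀ {e} → Reverses e → head G O' e ≡ tail G O e
    reversed-head {e} r = trans (head-half O' e)
      (trans (cong (λ s → half (e , not s)) r)
      (trans (cong (λ s → half (e , s)) (not-involutive (O e))) (sym (tail-half O e))))

    agreeing-tail : ∀ {e} → O' e ≡ O e → tail G O' e ≡ tail G O e
    agreeing-tail {e} s =
      trans (tail-half O' e) (trans (cong (λ s → half (e , s)) s) (sym (tail-half O e)))

    agreeing-head : ∀ {e} → O' e ≡ O e → head G O' e ≡ head G O e
    agreeing-head {e} s =
      trans (head-half O' e) (trans (cong (λ s → half (e , not s)) s) (sym (head-half O e)))

  module Walks (O : Orientation G) where

    OnWalk : ∀ {u v} → Walk G O u v → Fin nEdge → Set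
    OnWalk []           g = ⊥
    OnWalk (step e _ w) g = g ≡ e ⊎ OnWalk w g

    onWalk? : ∀ {u v} (w : Walk G O u v) → Decidable (OnWalk w)
    onWalk? []           g = no λ ()
    onWalk? (step e _ w) g = (g ≟ᶠ e) ⊎-dec (onWalk? w g)

    start-vertex : ∀ {u v} (w : Walk G O u v) → u ∈ walkVertices G w
    start-vertex []           = here refl
    start-vertex (step _ _ _) = here refl

    end-vertex : ∀ {u v} (w : Walk G O u v) → v ∈ walkVertices G w
    end-vertex []           = here refl
    end-vertex (step _ _ w) = there (end-vertex w)

    tail-vertex : ∀ {u v e} (w : Walk G O u v) → OnWalk w e → tail G O e ∈ walkVertices G w
    tail-vertex (step e p w) (inj₁ refl) = here p
    tail-vertex (step e _ w) (inj₂ e∈w)  = there (tail-vertex w e∈w)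

    head-vertex : ∀ {u v e} (w : Walk G O u v) → OnWalk w e → head G O e ∈ walkVertices G w
    head-vertex (step e _ w) (inj₁ refl) = there (start-vertex w)
    head-vertex (step e _ w) (inj₂ e∈w)  = there (head-vertex w e∈w)

    head-not-start : ∀ {u v e} (w : Walk G O u v) → Unique (walkVertices G w) →
                     OnWalk w e → head G O e ≢ u
    head-not-start (step e _ w) (u∉w ∷ _) (inj₁ refl) he =
      All¬⇒¬Any u∉w (subst (_∈ walkVertices G w) he (start-vertex w))
    head-not-start (step e _ w) (u∉w ∷ _) (inj₂ f∈w) hf =
      All¬⇒¬Any u∉w (subst (_∈ walkVertices G w) hf (head-vertex w f∈w))

    tail-not-end : ∀ {u v e} (w : Walk G O u v) → Unique (walkVertices G w) →
                   OnWalk w e → tail G O e ≢ v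
    tail-not-end (step e p w) (u∉w ∷ _) (inj₁ refl) te =
      All¬⇒¬Any u∉w (subst (_∈ walkVertices G w) (trans (sym te) p) (end-vertex w))
    tail-not-end (step e _ w) (_ ∷ w-uq) (inj₂ f∈w) tf = tail-not-end w w-uq f∈w tf

    heads-injective : ∀ {u v e f} (w : Walk G O u v) → Unique (walkVertices G w) →
                      OnWalk w e → OnWalk w f → head G O e ≡ head G O f → e ≡ f
    heads-injective (step e _ w) _ (inj₁ refl) (inj₁ refl) _ = refl
    heads-injective (step e _ w) (_ ∷ w-uq) (inj₁ refl) (inj₂ f∈w) he≡hf =
      ⊥-elim (head-not-start w w-uq f∈w (sym he≡hf))
    heads-injective (step e _ w) (_ ∷ w-uq) (inj₂ e∈w) (inj₁ refl) he≡hf =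
      ⊥-elim (head-not-start w w-uq e∈w he≡hf)
    heads-injective (step e _ w) (_ ∷ w-uq) (inj₂ e∈w) (inj₂ f∈w) he≡hf =
      heads-injective w w-uq e∈w f∈w he≡hf

    tails-injective : ∀ {u v e f} (w : Walk G O u v) → Unique (walkVertices G w) →
                      OnWalk w e → OnWalk w f → tail G O e ≡ tail G O f → e ≡ f
    tails-injective (step e _ w) _ (inj₁ refl) (inj₁ refl) _ = refl
    tails-injective (step e p w) (u∉w ∷ _) (inj₁ refl) (inj₂ f∈w) te≡tf =
      ⊥-elim (All¬⇒¬Any u∉w
        (subst (_∈ walkVertices G w) (trans (sym te≡tf) p) (tail-vertex w f∈w)))
    tails-injective (step e p w) (u∉w ∷ _) (inj₂ e∈w) (inj₁ refl) te≡tf =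
      ⊥-elim (All¬⇒¬Any u∉w
        (subst (_∈ walkVertices G w) (trans te≡tf p) (tail-vertex w e∈w)))
    tails-injective (step e _ w) (_ ∷ w-uq) (inj₂ e∈w) (inj₂ f∈w) te≡tf =
      tails-injective w w-uq e∈w f∈w te≡tf

    entering : ∀ {u v x} (w : Walk G O u v) → x ∈ walkVertices G w → x ≢ u →
               Σ[ e ∈ Fin nEdge ] OnWalk w e × head G O e ≡ x
    entering []           (here x≡u) x≢u = ⊥-elim (x≢u x≡u)
    entering []           (there ())
    entering (step e _ w) (here x≡u) x≢u = ⊥-elim (x≢u x≡u)
    entering {x = x} (step e _ w) (there x∈w) _ with x ≟V head G O e
    ... | yes x≡he = e , inj₁ refl , sym x≡he
    ... | no x≢he  = let f , f∈w , hf = entering w x∈w x≢he in f , inj₂ f∈w , hf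

    leaving : ∀ {u v x} (w : Walk G O u v) → x ∈ walkVertices G w → x ≢ v →
              Σ[ e ∈ Fin nEdge ] OnWalk w e × tail G O e ≡ x
    leaving []           (here x≡v) x≢v = ⊥-elim (x≢v x≡v)
    leaving []           (there ())
    leaving (step e p w) (here x≡u) _   = e , inj₁ refl , trans p (sym x≡u)
    leaving (step e _ w) (there x∈w) x≢v =
      let f , f∈w , tf = leaving w x∈w x≢v in f , inj₂ f∈w , tf

  module PathReversal (O : Orientation G) {i j : Fin n} (i≢j : i ≢ j)
                      (w : Walk G O (inj₁ i) (inj₁ j)) (w-uq : Unique (walkVertices G w)) where
    open Walks O

    O' : Orientation G
    O' = reverseOn (onWalk? w) O

    open Compare O O'

    on-reversed : ∀ {e} → OnWalk w e → Reverses e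
    on-reversed = reverseOn-on (onWalk? w) O

    off-agrees : ∀ {e} → ¬ OnWalk w e → O' e ≡ O e
    off-agrees = reverseOn-off (onWalk? w) O

    module Tails = Rerouting (onWalk? w) (tail G O) (head G O) (tail G O')
                     (reversed-tail ∘ on-reversed) (agreeing-tail ∘ off-agrees)
    module Heads = Rerouting (onWalk? w) (head G O) (tail G O) (head G O')
                     (reversed-head ∘ on-reversed) (agreeing-head ∘ off-agrees)

    i≢j-vertex : _≢_ {A = V} (inj₁ i) (inj₁ j)
    i≢j-vertex i≡j = i≢j (inj₁-injective i≡j)

    entered-too : ∀ {e x} → x ≢ inj₁ i → OnWalk w e → tail G O e ≡ x →
                  Σ[ f ∈ Fin nEdge ] OnWalk w f × head G O f ≡ x
    entered-too x≢i e∈w te = entering w (subst (_∈ walkVertices G w) te (tail-vertex w e∈w)) x≢i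

    left-too : ∀ {e x} → x ≢ inj₁ j → OnWalk w e → head G O e ≡ x →
               Σ[ f ∈ Fin nEdge ] OnWalk w f × tail G O f ≡ x
    left-too x≢j e∈w he = leaving w (subst (_∈ walkVertices G w) he (head-vertex w e∈w)) x≢j

    perfect' : IsPerfect G O → IsPerfect G O'
    perfect' perf v =
      (λ black → Tails.unique-rerouted
         (λ e∈w f∈w he hf → heads-injective w w-uq e∈w f∈w (trans he (sym hf)))
         (entered-too λ ()) (left-too λ ()) (proj₁ (perf v) black)) ,
      (λ white → Heads.unique-rerouted
         (λ e∈w f∈w te tf → tails-injective w w-uq e∈w f∈w (trans te (sym tf)))
         (left-too λ ()) (entered-too λ ()) (proj₂ (perf v) white))

    -- b_i stops being a source: the first path edge now enters it.
    i-not-source' : ¬ InSourceSet G O' i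
    i-not-source' src' =
      let e , e∈w , te = leaving w (start-vertex w) i≢j-vertex
      in src' e (trans (reversed-head (on-reversed e∈w)) te)

    -- b_j becomes a source: its only edge is the last path edge.
    j-source' : InSourceSet G O' j
    j-source' e he' with Heads.a'-cases he'
    ... | inj₁ (e∈w , te) = tail-not-end w w-uq e∈w te
    ... | inj₂ (e∉w , he) =
      let f , f∈w , hf = entering w (end-vertex w) (i≢j-vertex ∘ sym)
      in e∉w (subst (OnWalk w) (sym (boundary-heads-unique O he hf)) f∈w)

    source-kept : ∀ {x} → x ≢ i → InSourceSet G O x → InSourceSet G O' x
    source-kept x≢i = Heads.none-rerouted (entered-too (x≢i ∘ inj₁-injective))

    source-origin : ∀ {x} → x ≢ j → InSourceSet G O' x → InSourceSet G O x
    source-origin x≢j src' e he with onWalk? w e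
    ... | yes e∈w = let f , f∈w , tf = left-too (x≢j ∘ inj₁-injective) e∈w he
                    in src' f (trans (reversed-head (on-reversed f∈w)) tf)
    ... | no e∉w  = src' e (trans (agreeing-head (off-agrees e∉w)) he)

    exchanged-sources : HasSourceSet O' (Exchange O i j)
    exchanged-sources x = to , from
      where
      to : InSourceSet G O' x → Exchange O i j x
      to src' with x ≟ᶠ j
      ... | yes x≡j = inj₂ x≡j
      ... | no x≢j  = inj₁ (source-origin x≢j src' , x≢i)
        where
        x≢i : x ≢ i
        x≢i x≡i = i-not-source' (subst (InSourceSet G O') x≡i src')
      from : Exchange O i j x → InSourceSet G O' x
      from (inj₁ (src , x≢i)) = source-kept x≢i src
      from (inj₂ refl)        = j-source'

  -- Termination: paths have ≤ n + nInt vertices.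
  module TraceBack (O : Orientation G) {D : Fin nEdge → Set}
      (D-tails-unique : ∀ {e f y} → D e → D f → tail G O e ≡ y → tail G O f ≡ y → e ≡ f)
      (D-balanced : ∀ {e v} → D e → tail G O e ≡ inj₂ v →
                    Σ[ f ∈ Fin nEdge ] D f × head G O f ≡ inj₂ v)
      {z : V} (z-not-D-tail : ∀ {e} → D e → tail G O e ≢ z) where
    open Walks O

    DTail : V → Set
    DTail u = Σ[ e ∈ Fin nEdge ] D e × tail G O e ≡ u

    DPath : V → Set
    DPath u = Σ[ w ∈ Walk G O u z ] Unique (walkVertices G w) × (∀ e → OnWalk w e → D e)

    size : ∀ {u} → DPath u → ℕ
    size (w , _) = length (walkVertices G w)

    size≤ : ∀ {u} (p : DPath u) → size p ≤ n + nInt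
    size≤ (w , w-uq , _) = unique-length≤ (join n nInt) join-injective (walkVertices G w) w-uq

    -- Prepending a D-edge entering the start keeps a D-path: its tail is new,
    -- since an old vertex is z or is left by a path edge, hence by that edge.
    extend : ∀ {u f} → DPath u → D f → head G O f ≡ u → DPath (tail G O f)
    extend {f = f} (w , w-uq , in-D) df refl = step f refl w , tail∉w ∷ w-uq , in-D'
      where
      tail∉w' : tail G O f ∉ walkVertices G w
      tail∉w' tf∈w with tail G O f ≟V z
      ... | yes tf≡z = z-not-D-tail df tf≡z
      ... | no tf≢z  = let g , g∈w , tg = leaving w tf∈w tf≢z
                           f∈w = subst (OnWalk w) (D-tails-unique (in-D g g∈w) df tg refl) g∈w
                       in head-not-start w w-uq f∈w refl
      tail∉w = ¬Any⇒All¬ (walkVertices G w) tail∉w'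
      in-D' : ∀ e → OnWalk (step f refl w) e → D e
      in-D' e (inj₁ refl) = df
      in-D' e (inj₂ e∈w)  = in-D e e∈w

    size-extend : ∀ {u f} (p : DPath u) (df : D f) (hf : head G O f ≡ u) →
                  size (extend p df hf) ≡ suc (size p)
    size-extend _ _ refl = refl

    -- Extend backwards until the start is a boundary vertex.  The fuel bound
    -- makes running out of fuel contradict the pigeonhole bound on sizes.
    trace : (fuel : ℕ) {u : V} (p : DPath u) → DTail u → n + nInt <ℕ size p + fuel →
            Σ[ x ∈ Fin n ] DTail (inj₁ x) × DirectedPath G O (inj₁ x) z
    trace zero p _ long = ⊥-elim (<⇒≱ (subst (n + nInt <ℕ_) (+-identityʳ _) long) (size≤ p))
    trace (suc k) {inj₁ x} (w , w-uq , _) t _ = x , t , (w , w-uq)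
    trace (suc k) {inj₂ v} p (e , de , te) long =
      let f , df , hf = D-balanced de te
      in trace k (extend p df hf) (f , df , refl)
           (subst (λ s → n + nInt <ℕ s + k) (sym (size-extend p df hf))
             (subst (n + nInt <ℕ_) (+-suc (size p) k) long))

    trace-back : Σ[ e ∈ Fin nEdge ] D e × head G O e ≡ z →
                 Σ[ x ∈ Fin n ] DTail (inj₁ x) × DirectedPath G O (inj₁ x) z
    trace-back (e , de , he) = trace (n + nInt) (extend at-z de he) (e , de , refl)
      (subst (λ s → n + nInt <ℕ s + (n + nInt)) (sym (size-extend at-z de he))
        (m<n⇒m<1+n (n<1+n (n + nInt))))
      where
      at-z : DPath z
      at-z = [] , All.[] ∷ [] , λ _ ()

  module ExchangeTrace (O O' : Orientation G) (perf : IsPerfect G O) (perf' : IsPerfect G O')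
                       {i j : Fin n} (src-i : InSourceSet G O i) (nsrc-j : ¬ InSourceSet G O j)
                       (sources' : HasSourceSet O' (Exchange O i j)) where
    open Compare O O'

    -- Reversed edges leave distinct vertices of O: at a boundary vertex by
    -- degree one, at a black vertex since O has one out-edge there, and at a
    -- white vertex since a reversed edge leaving it in O enters it in O'.
    D-tails-unique : ∀ {e f y} → Reverses e → Reverses f →
                     tail G O e ≡ y → tail G O f ≡ y → e ≡ f
    D-tails-unique {y = inj₁ x} _ _ te tf = boundary-tails-unique O te tf
    D-tails-unique {y = inj₂ v} re rf te tf with colour v in cv
    ... | black = exactly-one-unique (proj₁ (perf v) cv) te tf
    ... | white = exactly-one-unique (proj₂ (perf' v) cv)
                    (trans (reversed-head re) te) (trans (reversed-head rf) tf)

    D-balanced : ∀ {e v} → Reverses e → tail G O e ≡ inj₂ v →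
                 Σ[ f ∈ Fin nEdge ] Reverses f × head G O f ≡ inj₂ v
    D-balanced {e} {v} re te with colour v in cv
    ... | black = Black.rerouted-in-P (proj₁ (perf v) cv)
                    (let e' , te' , _ = proj₁ (perf' v) cv in e' , te') (e , re , te)
      where
      module Black = Rerouting reverses? (tail G O) (head G O) (tail G O')
                       reversed-tail (agreeing-tail ∘ agrees)
    ... | white = White.rerouted-in-P (proj₂ (perf' v) cv)
                    (let e' , he' , _ = proj₂ (perf v) cv in e' , he')
                    (e , re , trans (reversed-head re) te)
      where
      module White = Rerouting reverses? (head G O') (head G O) (head G O)
                       (λ _ → refl) (sym ∘ agreeing-head ∘ agrees)

    -- The only boundary vertex left by a reversed edge is b_i: any other one
    -- would be a source of O, hence of O', yet is entered in O'.
    D-boundary-tail : ∀ {e x} → Reverses e → tail G O e ≡ inj₁ x → x ≡ i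
    D-boundary-tail {e} {x} re te = decidable-stable (x ≟ᶠ i) λ x≢i →
      proj₂ (sources' x) (inj₁ ((λ f → boundary-tail-not-head O te) , x≢i)) e
        (trans (reversed-head re) te)

    i≢j : i ≢ j
    i≢j = source≢non-source O src-i nsrc-j

    -- b_j is entered in O but is a source of O', so its edge is reversed.
    D-enters-j : Σ[ e ∈ Fin nEdge ] Reverses e × head G O e ≡ inj₁ j
    D-enters-j =
      let e , ¬¬he = ¬∀⟶∃¬ nEdge (λ e → head G O e ≢ inj₁ j)
                       (λ e → ¬? (head G O e ≟V inj₁ j)) nsrc-j
          he = decidable-stable (head G O e ≟V inj₁ j) ¬¬he
      in e , decidable-stable (reverses? e)
               (λ ¬re → proj₂ (sources' j) (inj₂ refl) e
                          (trans (agreeing-head (agrees ¬re)) he)) , he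

    open TraceBack O D-tails-unique D-balanced
      {inj₁ j} (λ re tj → i≢j (sym (D-boundary-tail re tj)))

    path : DirectedPath G O (inj₁ i) (inj₁ j)
    path =
      let x , (_ , re , te) , p = trace-back D-enters-j
      in subst (λ y → DirectedPath G O (inj₁ y) (inj₁ j)) (D-boundary-tail re te) p

proposition6p3 : {n : ℕ} (G : PlabicGraph n) (O : PerfectOrientation G) (i j : Fin n) →
    InSourceSet G (PerfectOrientation.orient O) i →
    ¬ InSourceSet G (PerfectOrientation.orient O) j →
    IsBasis G (λ x → (InSourceSet G (PerfectOrientation.orient O) x × x ≢ i) ⊎ x ≡ j)
      ⇔ DirectedPath G (PerfectOrientation.orient O) (inj₁ i) (inj₁ j)
proposition6p3 G O i j src-i nsrc-j = mk⇔ basis⇒path path⇒basis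
  where
  open PlabicFacts G
  open PerfectOrientation O renaming (orient to o; perfect to perf)

  basis⇒path : IsBasis G (Exchange o i j) → DirectedPath G o (inj₁ i) (inj₁ j)
  basis⇒path (O' , sources') =
    ExchangeTrace.path o (PerfectOrientation.orient O') perf (PerfectOrientation.perfect O')
      src-i nsrc-j sources'

  path⇒basis : DirectedPath G o (inj₁ i) (inj₁ j) → IsBasis G (Exchange o i j)
  path⇒basis (w , w-uq) =
    record { orient = O' ; perfect = perfect' perf } , exchanged-sources
    where open PathReversal o (source≢non-source o src-i nsrc-j) w w-uq
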